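{- Let $p,r\ge 1$ be integers. Then $\mathrm{ex}(n,S_{p,r},\textup{rainbow- }S_{p,r})=\Theta(n)$ as $n\to\infty$.
   Context: $S_{p,r}$ denotes the double star: the tree consisting of an edge $uv$ together with $p$ further vertices adjacent only to $u$ and $r$ further vertices adjacent only to $v$. An edge-coloring is proper if any two edges sharing a vertex receive different colors. A subgraph of an edge-colored graph is rainbow if all its edges have distinct colors. For graphs $H$ and $F$, $\mathrm{ex}(n,H,\textup{rainbow- }F)$ denotes the maximum number of copies of $H$ (subgraphs isomorphic to $H$) in a graph $G$ on $n$ vertices equipped with a proper edge-coloring in which there is no rainbow copy of $F$. -}

module Defs where

open import Data.Nat using (ℕ; zero; suc; _+_; _*_; _≤_; _<ᵇ_; _≡ᵇ_)
open import Data.Bool using (Bool; true; false; _∧_; _∨_; not)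
open import Data.Bool.Properties using (∨-comm)
open import Data.Fin using (Fin; toℕ)
open import Data.Product using (Σ; _×_; ∃-syntax; proj₁)
open import Data.Sum using (_⊎_)
open import Data.List using (List; length)
open import Data.List.Relation.Unary.All using (All)
open import Data.List.Relation.Unary.AllPairs using (AllPairs)
open import Relation.Binary.PropositionalEquality using (_≡_; _≢_; refl; trans; cong)
open import Relation.Nullary using (¬_)
open import Function.Definitions using (Injective)

record Graph (n : ℕ) : Set where
  field
    Adj    : Fin n → Fin n → Bool
    sym    : ∀ x y → Adj x y ≡ Adj y x
    irrefl : ∀ x → Adj x x ≡ false
open Graph public

-- An edge-colouring (colours are natural numbers): a colour for every
-- ordered pair, required to be symmetric on edges (values on non-edges
-- are irrelevant).
record EdgeColoring {n : ℕ} (G : Graph n) : Set where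
  field
    col     : Fin n → Fin n → ℕ
    col-sym : ∀ x y → Adj G x y ≡ true → col x y ≡ col y x
open EdgeColoring public

Proper : ∀ {n} {G : Graph n} → EdgeColoring G → Set
Proper {n} {G} c = ∀ (u v w : Fin n) → Adj G u v ≡ true → Adj G u w ≡ true →
                   v ≢ w → col c u v ≢ col c u w

record Subgraph {n : ℕ} (G : Graph n) : Set where
  field
    W     : Fin n → Bool
    E     : Fin n → Fin n → Bool
    E-sym : ∀ x y → E x y ≡ E y x
    E-sub : ∀ x y → E x y ≡ true → Adj G x y ≡ true
    E-W   : ∀ x y → E x y ≡ true → W x ≡ true
open Subgraph public

SameSubgraph : ∀ {n} {G : Graph n} → Subgraph G → Subgraph G → Set
SameSubgraph {n} S T = (∀ x → W S x ≡ W T x) × (∀ x y → E S x y ≡ E T x y)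

IsoTo : ∀ {n k} {G : Graph n} → Subgraph G → Graph k → Set
IsoTo {n} {k} S H =
  Σ (Fin k → Fin n) λ f →
    Injective _≡_ _≡_ f ×
    (∀ i → W S (f i) ≡ true) ×
    (∀ x → W S x ≡ true → ∃[ i ] f i ≡ x) ×
    (∀ i j → Adj H i j ≡ E S (f i) (f j))

Copy : ∀ {n k} → Graph n → Graph k → Set
Copy G H = Σ (Subgraph G) λ S → IsoTo S H

RainbowSub : ∀ {n} {G : Graph n} → EdgeColoring G → Subgraph G → Set
RainbowSub {n} c S = ∀ (x y x' y' : Fin n) → E S x y ≡ true → E S x' y' ≡ true →
  col c x y ≡ col c x' y' → (x ≡ x' × y ≡ y') ⊎ (x ≡ y' × y ≡ x')

NoRainbow : ∀ {n k} {G : Graph n} → EdgeColoring G → Graph k → Set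
NoRainbow {G = G} c F = ¬ (Σ (Copy G F) λ C → RainbowSub c (proj₁ C))

-- A list of pairwise distinct copies of H in G (distinct as subgraphs).
-- "G has at most m copies of H" iff every such list has length ≤ m.
DistinctCopies : ∀ {n k} (G : Graph n) (H : Graph k) → List (Copy G H) → Set
DistinctCopies G H L = AllPairs (λ a b → ¬ SameSubgraph (proj₁ a) (proj₁ b)) L

-- Double star S_{p,r} on vertex set Fin (2 + p + r):
-- vertex 0 = u, vertex 1 = v, vertices 2 .. p+1 are the leaves at u,
-- vertices p+2 .. p+r+1 are the leaves at v.
dsE : ℕ → ℕ → ℕ → ℕ → Bool
dsE p r a b =
  ((a ≡ᵇ 0) ∧ (b ≡ᵇ 1)) ∨
  ((a ≡ᵇ 0) ∧ (1 <ᵇ b) ∧ (b <ᵇ 2 + p)) ∨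
  ((a ≡ᵇ 1) ∧ (1 + p <ᵇ b) ∧ (b <ᵇ 2 + p + r))

dsAdj : ℕ → ℕ → ℕ → ℕ → Bool
dsAdj p r a b = dsE p r a b ∨ dsE p r b a

dsE-irrefl : ∀ p r a → dsE p r a a ≡ false
dsE-irrefl p r 0 = refl
dsE-irrefl p r 1 = refl
dsE-irrefl p r (suc (suc a)) = refl

DoubleStar : (p r : ℕ) → Graph (2 + p + r)
DoubleStar p r = record
  { Adj    = λ i j → dsAdj p r (toℕ i) (toℕ j)
  ; sym    = λ i j → ∨-comm (dsE p r (toℕ i) (toℕ j)) (dsE p r (toℕ j) (toℕ i))
  ; irrefl = λ i → trans (cong (λ z → z ∨ z) (dsE-irrefl p r (toℕ i))) refl
  }

-- If G is properly coloured and has no rainbow S_{p,r}, then both centres of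
-- every copy of S_{p,r} have degree below D = (p + r) + 2 (p + r + 2): otherwise the leaves
-- at one centre could be replaced by neighbours avoiding the vertices of the copy and the
-- colours at the other centre, and properness would make the new double star rainbow.
-- Rooting S_{p,r} at a centre, a copy is determined by the image of the root together with,
-- for every other vertex, the position of its image in the neighbour list of the image of
-- its parent; hence there are at most n · D ^ (p + r + 1) copies.
--
-- Take ⌊n / k⌋ disjoint copies of S_{p,r}, k = p + r + 2, colouring uv with 0
-- and the leaf edges at u and at v with 1, 2, ….  This proper colouring uses
-- max p r + 1 ≤ p + r colours on the p + r + 1 edges of any copy, so no copy is rainbow.

module Submission where

open import Defs
import Data.Nat as ℕ
import Data.Bool as Bool
open import Data.Bool using (true; false; _∧_)
open import Data.Bool.Properties using (⇔→≡; ∧-zeroʳ)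
open import Data.Nat using (ℕ; zero; suc; _+_; _*_; _^_; _≤_; _<_; z≤n; s≤s)
open import Data.Nat.Properties
open import Data.Nat.DivMod
open import Data.Nat.Divisibility using (n∣m*n)
open import Data.Fin as Fin using (Fin; zero; suc; toℕ; combine; splitAt; _↑ˡ_; _↑ʳ_)
import Data.Fin.Properties as Fin
open import Data.Fin.Properties using (toℕ-injective; pigeonhole; combine-injective; splitAt-<; splitAt-≥; toℕ-↑ˡ; toℕ-↑ʳ; ↑ˡ-injective; ↑ʳ-injective; splitAt⁻¹-↑ˡ; splitAt⁻¹-↑ʳ)
open import Data.List using (List; []; _∷_; length; lookup; filter; map; allFin; tabulate)
open import Data.List.Properties using (length-map; length-tabulate)
open import Data.List.Relation.Unary.All as All using (All; []; _∷_)
open import Data.List.Relation.Unary.AllPairs as AllPairs using (AllPairs; []; _∷_)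
import Data.List.Relation.Unary.AllPairs.Properties as AllPairsₚ
open import Data.List.Relation.Unary.Any using (index; any?)
open import Data.List.Membership.Propositional using (_∈_; _∉_)
open import Data.List.Membership.Propositional.Properties using (∈-lookup; ∈-filter⁺; ∈-filter⁻; ∈-allFin; ∈-map⁻; ∈-tabulate⁺)
open import Data.List.Relation.Unary.Unique.Propositional.Properties using (allFin⁺)
open import Data.List.Membership.Setoid.Properties using (index-injective)
open import Data.List.Relation.Binary.Subset.Propositional using (_⊆_)
open import Data.Product using (Σ; _×_; _,_; proj₁; proj₂; ∃-syntax)
open import Data.Sum using (_⊎_; inj₁; inj₂; [_,_]′)
open import Function using (_∘_; id)
open import Function.Definitions using (Injective)
open import Function.Bundles using (mk⇔)
open import Relation.Binary.PropositionalEquality as ≡ using (_≡_; _≢_; refl; trans; cong; cong₂; subst; subst₂)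
open import Relation.Nullary using (Dec; yes; no; does; contradiction; _×-dec_)
open import Relation.Nullary.Decidable using (dec-true; does-⇔)
open import Relation.Binary using (tri<; tri≈; tri>)
open import Relation.Unary using (Decidable)
open import Relation.Unary.Properties using (∁?)

module _ {A : Set} where

  lookup-AllPairs : ∀ {R : A → A → Set} {xs : List A} → AllPairs R xs →
                    ∀ {i j} → i Fin.< j → R (lookup xs i) (lookup xs j)
  lookup-AllPairs (Rx ∷ _)   {zero}  {suc j} _         = All.lookup Rx (∈-lookup j)
  lookup-AllPairs (_ ∷ Rxs) {suc i} {suc j} (s≤s i<j) = lookup-AllPairs Rxs i<j

  length-≤-⊆ : ∀ {xs ys : List A} → AllPairs _≢_ xs → xs ⊆ ys → length xs ≤ length ys
  length-≤-⊆ {xs} {ys} xs! xs⊆ys with length xs ≤? length ys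
  ... | yes fits = fits
  ... | no overflow with pigeonhole (≰⇒> overflow) (index ∘ xs⊆ys ∘ ∈-lookup)
  ... | i , j , i<j , same = contradiction
          (index-injective (≡.setoid A) (xs⊆ys (∈-lookup i)) (xs⊆ys (∈-lookup j)) same)
          (lookup-AllPairs xs! i<j)

  lookup-injective : ∀ {xs : List A} → AllPairs _≢_ xs → ∀ {i j} → lookup xs i ≡ lookup xs j → i ≡ j
  lookup-injective xs! {i} {j} same with Fin.<-cmp i j
  ... | tri< i<j _ _ = contradiction same (lookup-AllPairs xs! i<j)
  ... | tri≈ _ i≡j _ = i≡j
  ... | tri> _ _ j<i = contradiction (≡.sym same) (lookup-AllPairs xs! j<i)

  map-distinct : ∀ {B : Set} {P : A → Set} {xs : List A} (f : A → B) →
                 (∀ {a b} → P a → P b → f a ≡ f b → a ≡ b) →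
                 All P xs → AllPairs _≢_ xs → AllPairs _≢_ (map f xs)
  map-distinct {P = P} f inj Pxs xs! = AllPairsₚ.map⁺ (images-apart Pxs xs!)
    where
    images-apart : ∀ {xs} → All P xs → AllPairs _≢_ xs → AllPairs (λ a b → f a ≢ f b) xs
    images-apart []         []          = []
    images-apart (Pa ∷ Pas) (a≢ ∷ rest) =
      All.zipWith (λ (Pb , a≢b) fa≡fb → a≢b (inj Pa Pb fa≡fb)) (Pas , a≢) ∷ images-apart Pas rest

  ∉-tabulate : ∀ {m} (g : Fin m → A) {x} → x ∉ tabulate g → ∀ i → x ≢ g i
  ∉-tabulate g x∉ i refl = x∉ (∈-tabulate⁺ i)

  length-filter-∁ : {P : A → Set} (P? : Decidable P) (xs : List A) →
                    length xs ≤ length (filter P? xs) + length (filter (∁? P?) xs)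
  length-filter-∁ P? [] = z≤n
  length-filter-∁ P? (x ∷ xs) with P? x
  ... | yes _ = s≤s (length-filter-∁ P? xs)
  ... | no _  = ≤-trans (s≤s (length-filter-∁ P? xs)) (≤-reflexive (≡.sym (+-suc _ _)))

encode : ∀ {m d} → (Fin m → Fin d) → Fin (d ^ m)
encode {zero}  g = zero
encode {suc m} g = combine (g zero) (encode (g ∘ suc))

encode-injective : ∀ {m d} (g h : Fin m → Fin d) → encode g ≡ encode h → ∀ i → g i ≡ h i
encode-injective {suc m} g h eq i with combine-injective (g zero) _ (h zero) _ eq
encode-injective {suc m} g h eq zero    | g0≡h0 , _    = g0≡h0
encode-injective {suc m} g h eq (suc i) | _     , rest = encode-injective (g ∘ suc) (h ∘ suc) rest i

module _ {n : ℕ} (G : Graph n) where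

  adj⇒≢ : ∀ {x y} → Adj G x y ≡ true → x ≢ y
  adj⇒≢ {x} xy refl with trans (≡.sym xy) (irrefl G x)
  ... | ()

  adjacent? : ∀ x → Decidable (λ y → Adj G x y ≡ true)
  adjacent? x y = Adj G x y Bool.≟ true

  neighbours : Fin n → List (Fin n)
  neighbours x = filter (adjacent? x) (allFin n)

  degree : Fin n → ℕ
  degree x = length (neighbours x)

  ∈-neighbours⁺ : ∀ {x y} → Adj G x y ≡ true → y ∈ neighbours x
  ∈-neighbours⁺ {x} xy = ∈-filter⁺ (adjacent? x) (∈-allFin _) xy

  ∈-neighbours⁻ : ∀ {x y} → y ∈ neighbours x → Adj G x y ≡ true
  ∈-neighbours⁻ {x} y∈ = proj₂ (∈-filter⁻ (adjacent? x) {xs = allFin n} y∈)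

  neighbours-distinct : ∀ x → AllPairs _≢_ (neighbours x)
  neighbours-distinct x = AllPairsₚ.filter⁺ (adjacent? x) (allFin⁺ n)

  neighbour-index-injective : ∀ {x x′ y y′} → x ≡ x′ → (y∈ : y ∈ neighbours x) (y′∈ : y′ ∈ neighbours x′) →
                              toℕ (index y∈) ≡ toℕ (index y′∈) → y ≡ y′
  neighbour-index-injective refl y∈ y′∈ same = index-injective (≡.setoid (Fin n)) y∈ y′∈ (toℕ-injective same)

module _ {n : ℕ} {G : Graph n} (c : EdgeColoring G) (proper : Proper c) where

  proper-injective : ∀ {x y z} → Adj G x y ≡ true → Adj G x z ≡ true →
                     col c x y ≡ col c x z → y ≡ z
  proper-injective {x} {y} {z} xy xz same with y Fin.≟ z
  ... | yes y≡z = y≡z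
  ... | no y≢z  = contradiction same (proper x y z xy xz y≢z)

  module _ (x : Fin n) (XS : List (Fin n)) (YS : List ℕ) where

    private
      seen? : Decidable (_∈ XS)
      seen? w = any? (w Fin.≟_) XS

      clashes? : Decidable (λ w → col c x w ∈ YS)
      clashes? w = any? (col c x w ℕ.≟_) YS

      unseen : List (Fin n)
      unseen = filter (∁? seen?) (neighbours G x)

      fresh : List (Fin n)
      fresh = filter (∁? clashes?) unseen

      unseen⊆ : unseen ⊆ neighbours G x
      unseen⊆ = proj₁ ∘ ∈-filter⁻ (∁? seen?) {xs = neighbours G x}

      fresh⊆ : fresh ⊆ unseen
      fresh⊆ = proj₁ ∘ ∈-filter⁻ (∁? clashes?) {xs = unseen}

      unseen-distinct : AllPairs _≢_ unseen
      unseen-distinct = AllPairsₚ.filter⁺ (∁? seen?) (neighbours-distinct G x)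

      seen-bound : length (filter seen? (neighbours G x)) ≤ length XS
      seen-bound = length-≤-⊆ (AllPairsₚ.filter⁺ seen? (neighbours-distinct G x))
                              (proj₂ ∘ ∈-filter⁻ seen? {xs = neighbours G x})

      clashing-bound : length (filter clashes? unseen) ≤ length YS
      clashing-bound = begin
        length (filter clashes? unseen)                 ≡⟨ length-map (col c x) (filter clashes? unseen) ⟨
        length (map (col c x) (filter clashes? unseen)) ≤⟨ length-≤-⊆ distinct-colours colours⊆YS ⟩
        length YS                                       ∎
        where
        open ≤-Reasoning
        clashing⊆ : filter clashes? unseen ⊆ unseen
        clashing⊆ = proj₁ ∘ ∈-filter⁻ clashes? {xs = unseen}
        adjacent : All (λ w → Adj G x w ≡ true) (filter clashes? unseen)
        adjacent = All.tabulate (∈-neighbours⁻ G ∘ unseen⊆ ∘ clashing⊆)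
        distinct-colours : AllPairs _≢_ (map (col c x) (filter clashes? unseen))
        distinct-colours = map-distinct (col c x) proper-injective adjacent
                                        (AllPairsₚ.filter⁺ clashes? unseen-distinct)
        colours⊆YS : map (col c x) (filter clashes? unseen) ⊆ YS
        colours⊆YS y∈ with _ , w∈ , refl ← ∈-map⁻ (col c x) y∈ = proj₂ (∈-filter⁻ clashes? {xs = unseen} w∈)

      degree-bound : degree G x ≤ length XS + (length YS + length fresh)
      degree-bound = begin
        degree G x
          ≤⟨ length-filter-∁ seen? (neighbours G x) ⟩
        length (filter seen? (neighbours G x)) + length unseen
          ≤⟨ +-mono-≤ seen-bound (length-filter-∁ clashes? unseen) ⟩
        length XS + (length (filter clashes? unseen) + length fresh)
          ≤⟨ +-monoʳ-≤ (length XS) (+-monoˡ-≤ (length fresh) clashing-bound) ⟩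
        length XS + (length YS + length fresh)
          ∎
        where open ≤-Reasoning

    fresh-neighbours : ∀ q → length XS + (length YS + q) ≤ degree G x →
      Σ (Fin q → Fin n) λ A → Injective _≡_ _≡_ A × (∀ a → Adj G x (A a) ≡ true) ×
                              (∀ a → A a ∉ XS) × (∀ a → col c x (A a) ∉ YS)
    fresh-neighbours q room = A , A-injective , A-adjacent , A-unseen , A-fresh
      where
      q≤fresh : q ≤ length fresh
      q≤fresh = +-cancelˡ-≤ (length YS) q _ (+-cancelˡ-≤ (length XS) _ _ (≤-trans room degree-bound))
      A : Fin q → Fin n
      A a = lookup fresh (Fin.inject≤ a q≤fresh)
      A-injective : Injective _≡_ _≡_ A
      A-injective same = Fin.inject≤-injective _ _ _ _
        (lookup-injective (AllPairsₚ.filter⁺ (∁? clashes?) unseen-distinct) same)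
      A-adjacent : ∀ a → Adj G x (A a) ≡ true
      A-adjacent a = ∈-neighbours⁻ G (unseen⊆ (fresh⊆ (∈-lookup _)))
      A-unseen : ∀ a → A a ∉ XS
      A-unseen a = proj₂ (∈-filter⁻ (∁? seen?) {xs = neighbours G x} (fresh⊆ (∈-lookup _)))
      A-fresh : ∀ a → col c x (A a) ∉ YS
      A-fresh a = proj₂ (∈-filter⁻ (∁? clashes?) {xs = unseen} (∈-lookup _))

record Embedding {k n : ℕ} (H : Graph k) (G : Graph n) : Set where
  field
    vertex    : Fin k → Fin n
    injective : Injective _≡_ _≡_ vertex
    adjacent  : ∀ {i j} → Adj H i j ≡ true → Adj G (vertex i) (vertex j) ≡ true
open Embedding

witness : ∀ {A : Set} (a? : Dec A) → does a? ≡ true → A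
witness (yes a) _ = a

module _ {k n : ℕ} {H : Graph k} {G : Graph n} where

  EdgesDistinctlyColoured : EdgeColoring G → (Fin k → Fin n) → Set
  EdgesDistinctlyColoured c f = ∀ {i j i′ j′} → Adj H i j ≡ true → Adj H i′ j′ ≡ true →
    col c (f i) (f j) ≡ col c (f i′) (f j′) → (i ≡ i′ × j ≡ j′) ⊎ (i ≡ j′ × j ≡ i′)

  module _ (φ : Embedding H G) where

    private
      Hit : Fin n → Set
      Hit x = ∃[ i ] vertex φ i ≡ x

      hit? : Decidable Hit
      hit? x = Fin.any? (λ i → vertex φ i Fin.≟ x)

      Joins : Fin n → Fin n → Set
      Joins x y = ∃[ i ] ∃[ j ] Adj H i j ≡ true × vertex φ i ≡ x × vertex φ j ≡ y

      joins? : ∀ x y → Dec (Joins x y)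
      joins? x y = Fin.any? λ i → Fin.any? λ j →
        (Adj H i j Bool.≟ true) ×-dec (vertex φ i Fin.≟ x) ×-dec (vertex φ j Fin.≟ y)

      joins-sym : ∀ x y → does (joins? x y) ≡ true → does (joins? y x) ≡ true
      joins-sym x y xy with witness (joins? x y) xy
      ... | i , j , ij , refl , refl = dec-true (joins? y x) (j , i , trans (sym H j i) ij , refl , refl)

      joins⇒adjacent : ∀ x y → does (joins? x y) ≡ true → Adj G x y ≡ true
      joins⇒adjacent x y xy with witness (joins? x y) xy
      ... | i , j , ij , refl , refl = adjacent φ ij

      joins⇒hit : ∀ x y → does (joins? x y) ≡ true → does (hit? x) ≡ true
      joins⇒hit x y xy with witness (joins? x y) xy
      ... | i , _ , _ , refl , _ = dec-true (hit? x) (i , refl)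

      joins-reflects : ∀ i j → does (joins? (vertex φ i) (vertex φ j)) ≡ true → Adj H i j ≡ true
      joins-reflects i j xy with witness (joins? _ _) xy
      ... | i′ , j′ , i′j′ , i′≡i , j′≡j
        rewrite injective φ i′≡i | injective φ j′≡j = i′j′

    image : Subgraph G
    image = record
      { W     = λ x → does (hit? x)
      ; E     = λ x y → does (joins? x y)
      ; E-sym = λ x y → ⇔→≡ (mk⇔ (joins-sym x y) (joins-sym y x))
      ; E-sub = joins⇒adjacent
      ; E-W   = joins⇒hit
      }

    imageCopy : Copy G H
    imageCopy = image , vertex φ , injective φ
              , (λ i → dec-true (hit? _) (i , refl))
              , (λ x → witness (hit? x))
              , λ i j → ⇔→≡ (mk⇔ (λ ij → dec-true (joins? _ _) (i , j , ij , refl , refl))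
                                 (joins-reflects i j))

    image-rainbow : (c : EdgeColoring G) → EdgesDistinctlyColoured c (vertex φ) → RainbowSub c image
    image-rainbow c distinct x y x′ y′ xy x′y′ same
      with witness (joins? x y) xy | witness (joins? x′ y′) x′y′
    ... | i , j , ij , refl , refl | i′ , j′ , i′j′ , refl , refl with distinct ij i′j′ same
    ... | inj₁ (refl , refl) = inj₁ (refl , refl)
    ... | inj₂ (refl , refl) = inj₂ (refl , refl)

  embedding : Copy G H → Embedding H G
  embedding (S , f , f-injective , _ , _ , iso) = record
    { vertex    = f
    ; injective = f-injective
    ; adjacent  = λ {i} {j} ij → E-sub S (f i) (f j) (trans (≡.sym (iso i j)) ij)
    }

  sameSubgraph⇒vertex-shared : (C C′ : Copy G H) → SameSubgraph (proj₁ C) (proj₁ C′) →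
                               ∀ i → ∃[ j ] vertex (embedding C′) j ≡ vertex (embedding C) i
  sameSubgraph⇒vertex-shared (_ , f , _ , f∈ , _ , _) (_ , _ , _ , _ , onto′ , _) (sameW , _) i =
    onto′ (f i) (trans (≡.sym (sameW (f i))) (f∈ i))

  rainbow⇒edgesDistinctlyColoured : (c : EdgeColoring G) (C : Copy G H) →
    RainbowSub c (proj₁ C) → EdgesDistinctlyColoured c (vertex (embedding C))
  rainbow⇒edgesDistinctlyColoured c (S , f , f-injective , _ , _ , iso) rainbow {i} {j} {i′} {j′} ij i′j′ same
    with rainbow (f i) (f j) (f i′) (f j′) (trans (≡.sym (iso i j)) ij) (trans (≡.sym (iso i′ j′)) i′j′) same
  ... | inj₁ (p , q) = inj₁ (f-injective p , f-injective q)
  ... | inj₂ (p , q) = inj₂ (f-injective p , f-injective q)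

  copy-determined : (C C′ : Copy G H) → (∀ i → vertex (embedding C) i ≡ vertex (embedding C′) i) →
                    SameSubgraph (proj₁ C) (proj₁ C′)
  copy-determined C C′ same =
    (λ x → ⇔→≡ (mk⇔ (vertex-transfer C C′ same x) (vertex-transfer C′ C (≡.sym ∘ same) x))) ,
    (λ x y → ⇔→≡ (mk⇔ (edge-transfer C C′ same x y) (edge-transfer C′ C (≡.sym ∘ same) x y)))
    where
    vertex-transfer : (C C′ : Copy G H) → (∀ i → vertex (embedding C) i ≡ vertex (embedding C′) i) →
                      ∀ x → W (proj₁ C) x ≡ true → W (proj₁ C′) x ≡ true
    vertex-transfer (_ , _ , _ , _ , onto , _) (S′ , _ , _ , W′ , _ , _) same x x∈ with onto x x∈
    ... | i , refl = subst (λ z → W S′ z ≡ true) (≡.sym (same i)) (W′ i)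
    edge-transfer : (C C′ : Copy G H) → (∀ i → vertex (embedding C) i ≡ vertex (embedding C′) i) →
                    ∀ x y → E (proj₁ C) x y ≡ true → E (proj₁ C′) x y ≡ true
    edge-transfer (S , f , _ , _ , onto , iso) (S′ , f′ , _ , _ , _ , iso′) same x y xy
      with onto x (E-W S x y xy) | onto y (E-W S y x (trans (E-sym S y x) xy))
    ... | i , refl | j , refl =
      subst₂ (λ u v → E S′ u v ≡ true) (≡.sym (same i)) (≡.sym (same j))
             (trans (≡.sym (iso′ i j)) (trans (iso i j) xy))

module _ {k : ℕ} (H : Graph (suc k)) (n : ℕ) where

  block : Fin n → ℕ
  block x = toℕ x / suc k

  position : Fin n → Fin (suc k)
  position x = toℕ x mod suc k

  disjointCopies : Graph n
  disjointCopies = record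
    { Adj    = λ x y → (block x ℕ.≡ᵇ block y) ∧ Adj H (position x) (position y)
    -- does (m ℕ.≟ n) computes to m ℕ.≡ᵇ n
    ; sym    = λ x y → cong₂ _∧_ (does-⇔ (mk⇔ ≡.sym ≡.sym) (block x ℕ.≟ block y) (block y ℕ.≟ block x))
                                 (sym H (position x) (position y))
    ; irrefl = λ x → trans (cong ((block x ℕ.≡ᵇ block x) ∧_) (irrefl H (position x))) (∧-zeroʳ _)
    }

  adjacent⁻ : ∀ {x y} → Adj disjointCopies x y ≡ true →
              block x ≡ block y × Adj H (position x) (position y) ≡ true
  adjacent⁻ {x} {y} xy with block x ℕ.≡ᵇ block y | ≡ᵇ⇒≡ (block x) (block y)
  ... | true | same = same _ , xy

  toℕ-block-position : ∀ x → toℕ x ≡ toℕ (position x) + block x * suc k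
  toℕ-block-position x = trans (m≡m%n+[m/n]*n (toℕ x) (suc k))
                               (cong (_+ block x * suc k) (≡.sym (Fin.toℕ-fromℕ< _)))

  block-position-injective : ∀ {x y} → block x ≡ block y → position x ≡ position y → x ≡ y
  block-position-injective {x} {y} blocks positions = toℕ-injective (begin
    toℕ x                                ≡⟨ toℕ-block-position x ⟩
    toℕ (position x) + block x * suc k   ≡⟨ cong₂ (λ i q → toℕ i + q * suc k) positions blocks ⟩
    toℕ (position y) + block y * suc k   ≡⟨ toℕ-block-position y ⟨
    toℕ y                                ∎)
    where open ≡.≡-Reasoning

  module _ (c : EdgeColoring H) where

    liftedColouring : EdgeColoring disjointCopies
    liftedColouring = record
      { col     = λ x y → col c (position x) (position y)
      ; col-sym = λ x y xy → col-sym c (position x) (position y) (proj₂ (adjacent⁻ {x} {y} xy))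
      }

    liftedColouring-proper : Proper c → Proper liftedColouring
    liftedColouring-proper proper x y z xy xz y≢z with adjacent⁻ {x} {y} xy | adjacent⁻ {x} {z} xz
    ... | bxy , Hxy | bxz , Hxz = proper (position x) (position y) (position z) Hxy Hxz
                                         (y≢z ∘ block-position-injective (trans (≡.sym bxy) bxz))

    liftedColouring-bounded : ∀ {m} → (∀ i j → Adj H i j ≡ true → col c i j < m) →
                              ∀ x y → Adj disjointCopies x y ≡ true → col liftedColouring x y < m
    liftedColouring-bounded bounded x y xy = bounded _ _ (proj₂ (adjacent⁻ {x} {y} xy))

  module _ (q : ℕ) (q<blocks : q < n / suc k) where

    private
      inBounds : ∀ i → toℕ i + q * suc k < n
      inBounds i = begin-strict
        toℕ i + q * suc k      <⟨ +-monoˡ-< (q * suc k) (Fin.toℕ<n i) ⟩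
        suc q * suc k          ≤⟨ *-monoˡ-≤ (suc k) q<blocks ⟩
        n / suc k * suc k      ≤⟨ m/n*n≤m n (suc k) ⟩
        n                      ∎
        where open ≤-Reasoning

      member : Fin (suc k) → Fin n
      member i = Fin.fromℕ< (inBounds i)

      toℕ-member : ∀ i → toℕ (member i) ≡ toℕ i + q * suc k
      toℕ-member i = Fin.toℕ-fromℕ< (inBounds i)

    block-member : ∀ i → block (member i) ≡ q
    block-member i = begin
      (toℕ (member i)) / suc k                 ≡⟨ cong (_/ suc k) (toℕ-member i) ⟩
      (toℕ i + q * suc k) / suc k              ≡⟨ +-distrib-/-∣ʳ (toℕ i) (n∣m*n q) ⟩
      toℕ i / suc k + q * suc k / suc k        ≡⟨ cong₂ _+_ (m<n⇒m/n≡0 (Fin.toℕ<n i)) (m*n/n≡m q (suc k)) ⟩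
      q                                        ∎
      where open ≡.≡-Reasoning

    position-member : ∀ i → position (member i) ≡ i
    position-member i = toℕ-injective (begin
      toℕ (position (member i))   ≡⟨ Fin.toℕ-fromℕ< _ ⟩
      toℕ (member i) % suc k      ≡⟨ cong (_% suc k) (toℕ-member i) ⟩
      (toℕ i + q * suc k) % suc k ≡⟨ [m+kn]%n≡m%n (toℕ i) q (suc k) ⟩
      toℕ i % suc k               ≡⟨ m<n⇒m%n≡m (Fin.toℕ<n i) ⟩
      toℕ i                       ∎)
      where open ≡.≡-Reasoning

    blockEmbedding : Embedding H disjointCopies
    blockEmbedding = record
      { vertex    = member
      ; injective = λ {i} {j} same → toℕ-injective (+-cancelʳ-≡ (q * suc k) (toℕ i) (toℕ j)
                      (trans (≡.sym (toℕ-member i)) (trans (cong toℕ same) (toℕ-member j))))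
      ; adjacent  = λ {i} {j} ij → subst₂ (λ a b → (block (member i) ℕ.≡ᵇ block (member j)) ∧ Adj H a b ≡ true)
                      (≡.sym (position-member i)) (≡.sym (position-member j))
                      (trans (cong (_∧ Adj H i j) (dec-true (block (member i) ℕ.≟ block (member j))
                                                            (trans (block-member i) (≡.sym (block-member j))))) ij)
      }

  blockCopies : List (Copy disjointCopies H)
  blockCopies = tabulate (λ q → imageCopy (blockEmbedding (toℕ q) (Fin.toℕ<n q)))

  blockCopies-distinct : DistinctCopies disjointCopies H blockCopies
  blockCopies-distinct = AllPairsₚ.tabulate⁺ λ {q} {q′} q≢q′ same →
    let j , shared = sameSubgraph⇒vertex-shared {H = H}
                       (imageCopy (blockEmbedding (toℕ q) (Fin.toℕ<n q)))
                       (imageCopy (blockEmbedding (toℕ q′) (Fin.toℕ<n q′))) same zero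
    in q≢q′ (toℕ-injective (trans (≡.sym (block-member (toℕ q) (Fin.toℕ<n q) zero))
                           (trans (cong block (≡.sym shared)) (block-member (toℕ q′) (Fin.toℕ<n q′) j))))

  blockCopies-many : suc k ≤ n → n ≤ (suc k + suc k) * length blockCopies
  blockCopies-many k<n = begin
    n                                         ≡⟨ m≡m%n+[m/n]*n n (suc k) ⟩
    n % suc k + n / suc k * suc k             ≤⟨ +-monoˡ-≤ _ (<⇒≤ (m%n<n n (suc k))) ⟩
    suc k + n / suc k * suc k                 ≡⟨ cong (_+ n / suc k * suc k) (*-identityˡ (suc k)) ⟨
    1 * suc k + n / suc k * suc k             ≤⟨ +-monoˡ-≤ _ (*-monoˡ-≤ (suc k) (m≥n⇒m/n>0 k<n)) ⟩
    n / suc k * suc k + n / suc k * suc k     ≡⟨ *-distribˡ-+ (n / suc k) (suc k) (suc k) ⟨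
    n / suc k * (suc k + suc k)               ≡⟨ *-comm (n / suc k) _ ⟩
    (suc k + suc k) * (n / suc k)             ≡⟨ cong ((suc k + suc k) *_) (length-tabulate _) ⟨
    (suc k + suc k) * length blockCopies      ∎
    where open ≤-Reasoning

module _ (p r : ℕ) where

  private
    k : ℕ
    k = 2 + p + r

  -- Vertices 0 and 1 are the centres u and v; every other vertex suc e hangs from parent e,
  -- so the edges of S_{p,r} are the pairs {parent e, suc e}.
  parent : Fin (suc (p + r)) → Fin k
  parent zero    = zero
  parent (suc i) = [ (λ _ → zero) , (λ _ → suc zero) ]′ (splitAt p i)

  ParentEdge : Fin (suc (p + r)) → Fin k → Fin k → Set
  ParentEdge e i j = (i ≡ parent e × j ≡ suc e) ⊎ (i ≡ suc e × j ≡ parent e)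

  leafᵤ : Fin p → Fin k
  leafᵤ a = suc (suc (a ↑ˡ r))

  leafᵥ : Fin r → Fin k
  leafᵥ b = suc (suc (p ↑ʳ b))

  parent-centre : ∀ e → parent e ≡ zero ⊎ parent e ≡ suc zero
  parent-centre zero = inj₁ refl
  parent-centre (suc i) with splitAt p i
  ... | inj₁ _ = inj₁ refl
  ... | inj₂ _ = inj₂ refl

  parent≡suc⇒zero : ∀ {e e′} → parent e ≡ suc e′ → e′ ≡ zero
  parent≡suc⇒zero {e} eq with parent-centre e
  ... | inj₁ e↦0 with () ← trans (≡.sym e↦0) eq
  ... | inj₂ e↦1 = ≡.sym (Fin.suc-injective (trans (≡.sym e↦1) eq))

  parent-edges-not-reversed : ∀ {e e′} → parent e ≡ suc e′ → suc e ≢ parent e′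
  parent-edges-not-reversed {e} {e′} e↦e′ e′↦e
    with refl ← parent≡suc⇒zero {e′} (≡.sym e′↦e) with () ← e↦e′

  parent-suc-< : ∀ {i} → toℕ i < p → parent (suc i) ≡ zero
  parent-suc-< {i} i<p rewrite splitAt-< p i i<p = refl

  parent-suc-≥ : ∀ {i} → p ≤ toℕ i → parent (suc i) ≡ suc zero
  parent-suc-≥ {i} p≤i rewrite splitAt-≥ p i p≤i = refl

  adjacent-parent : ∀ e → Adj (DoubleStar p r) (parent e) (suc e) ≡ true
  adjacent-parent zero    = refl
  adjacent-parent (suc i) with toℕ i ℕ.<? p
  ... | yes i<p rewrite parent-suc-< i<p = adjacentᵤ i<p
    where
    adjacentᵤ : toℕ i < p → dsAdj p r 0 (2 + toℕ i) ≡ true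
    adjacentᵤ i<p with toℕ i ℕ.<ᵇ p | <⇒<ᵇ i<p
    ... | true | _ = refl
  ... | no i≮p rewrite parent-suc-≥ (≮⇒≥ i≮p) = adjacentᵥ (s≤s (≮⇒≥ i≮p)) (Fin.toℕ<n i)
    where
    adjacentᵥ : p < suc (toℕ i) → toℕ i < p + r → dsAdj p r 1 (2 + toℕ i) ≡ true
    adjacentᵥ h₁ h₂ with p ℕ.<ᵇ suc (toℕ i) | <⇒<ᵇ h₁ | toℕ i ℕ.<ᵇ p + r | <⇒<ᵇ h₂
    ... | true | _ | true | _ = refl

  private
    dsE⇒parent-edge : ∀ i j → dsE p r (toℕ i) (toℕ j) ≡ true → ∃[ e ] i ≡ parent e × j ≡ suc e
    dsE⇒parent-edge zero (suc zero) _ = zero , refl , refl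
    dsE⇒parent-edge zero (suc (suc t)) ij with toℕ t ℕ.<ᵇ p | <ᵇ⇒< (toℕ t) p
    ... | true | t<p = suc t , ≡.sym (parent-suc-< (t<p _)) , refl
    dsE⇒parent-edge (suc zero) (suc (suc t)) ij
      with p ℕ.<ᵇ suc (toℕ t) | <ᵇ⇒< p (suc (toℕ t))
    ... | true | p<t+1 = suc t , ≡.sym (parent-suc-≥ (ℕ.s≤s⁻¹ (p<t+1 _))) , refl
    dsE⇒parent-edge zero zero ()
    dsE⇒parent-edge (suc zero) zero ()
    dsE⇒parent-edge (suc zero) (suc zero) ()
    dsE⇒parent-edge (suc (suc _)) _ ()

  adjacent⇒parent-edge : ∀ i j → Adj (DoubleStar p r) i j ≡ true →
                         ∃[ e ] ParentEdge e i j
  adjacent⇒parent-edge i j ij with dsE p r (toℕ i) (toℕ j) in forward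
  ... | true  = let e , i↦e , j↦e = dsE⇒parent-edge i j forward in e , inj₁ (i↦e , j↦e)
  ... | false = let e , j↦e , i↦e = dsE⇒parent-edge j i ij in e , inj₂ (i↦e , j↦e)

  adjacent-leafᵤ : ∀ a → Adj (DoubleStar p r) zero (leafᵤ a) ≡ true
  adjacent-leafᵤ a = subst (λ x → Adj (DoubleStar p r) x (leafᵤ a) ≡ true)
    (parent-suc-< (subst (_< p) (≡.sym (toℕ-↑ˡ a r)) (Fin.toℕ<n a)))
    (adjacent-parent (suc (a ↑ˡ r)))

  adjacent-leafᵥ : ∀ b → Adj (DoubleStar p r) (suc zero) (leafᵥ b) ≡ true
  adjacent-leafᵥ b = subst (λ x → Adj (DoubleStar p r) x (leafᵥ b) ≡ true)
    (parent-suc-≥ (subst (p ≤_) (≡.sym (toℕ-↑ʳ p b)) (m≤m+n p (toℕ b))))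
    (adjacent-parent (suc (p ↑ʳ b)))

  module _ {n : ℕ} {G : Graph n} where

    private
      H : Graph (2 + p + r)
      H = DoubleStar p r

    parentEdges⇒embedding : (f : Fin (2 + p + r) → Fin n) → Injective _≡_ _≡_ f →
                            (∀ e → Adj G (f (parent e)) (f (suc e)) ≡ true) → Embedding H G
    parentEdges⇒embedding f f-injective edges = record
      { vertex = f ; injective = f-injective ; adjacent = λ {i} {j} → preserves i j }
      where
      preserves : ∀ i j → Adj H i j ≡ true → Adj G (f i) (f j) ≡ true
      preserves i j ij with adjacent⇒parent-edge i j ij
      ... | e , inj₁ (refl , refl) = edges e
      ... | e , inj₂ (refl , refl) = trans (sym G (f (suc e)) (f (parent e))) (edges e)

    edgeColour : EdgeColoring G → (Fin (2 + p + r) → Fin n) → Fin (suc (p + r)) → ℕ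
    edgeColour c f e = col c (f (parent e)) (f (suc e))

    module _ (c : EdgeColoring G) where

      distinctlyColoured⇒edgeColour-injective : ∀ {f} → EdgesDistinctlyColoured {H = H} c f →
                                                Injective _≡_ _≡_ (edgeColour c f)
      distinctlyColoured⇒edgeColour-injective distinct {e} {e′} same
        with distinct (adjacent-parent e) (adjacent-parent e′) same
      ... | inj₁ (_ , e+1≡e′+1) = Fin.suc-injective e+1≡e′+1
      ... | inj₂ (e↦e′ , e′↦e) = contradiction e′↦e (parent-edges-not-reversed e↦e′)

      edgeColour-injective⇒rainbow : (φ : Embedding H G) → Injective _≡_ _≡_ (edgeColour c (vertex φ)) →
                                     RainbowSub c (image φ)
      edgeColour-injective⇒rainbow φ injective = image-rainbow φ c distinct
        where
        f = vertex φ
        colour-of-edge : ∀ {i j} → Adj H i j ≡ true → ∃[ e ] ParentEdge e i j × col c (f i) (f j) ≡ edgeColour c f e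
        colour-of-edge {i} {j} ij with adjacent⇒parent-edge i j ij
        ... | e , inj₁ (refl , refl) = e , inj₁ (refl , refl) , refl
        ... | e , inj₂ (refl , refl) = e , inj₂ (refl , refl) , col-sym c (f i) (f j) (adjacent φ ij)
        distinct : EdgesDistinctlyColoured {H = H} c f
        distinct ij i′j′ same with colour-of-edge ij | colour-of-edge i′j′
        ... | e , o , κ | e′ , o′ , κ′ with injective (trans (≡.sym κ) (trans same κ′))
        distinct _ _ _ | e , inj₁ (refl , refl) , _ | e , inj₁ (refl , refl) , _ | refl = inj₁ (refl , refl)
        distinct _ _ _ | e , inj₁ (refl , refl) , _ | e , inj₂ (refl , refl) , _ | refl = inj₂ (refl , refl)
        distinct _ _ _ | e , inj₂ (refl , refl) , _ | e , inj₁ (refl , refl) , _ | refl = inj₂ (refl , refl)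
        distinct _ _ _ | e , inj₂ (refl , refl) , _ | e , inj₂ (refl , refl) , _ | refl = inj₁ (refl , refl)

  module _ {n : ℕ} {G : Graph n} (c : EdgeColoring G) where

    record SeparatedDoubleStar (u v : Fin n) (A : Fin p → Fin n) (B : Fin r → Fin n) : Set where
      field
        uv-adjacent       : Adj G u v ≡ true
        uA-adjacent       : ∀ a → Adj G u (A a) ≡ true
        vB-adjacent       : ∀ b → Adj G v (B b) ≡ true
        A-injective       : Injective _≡_ _≡_ A
        B-injective       : Injective _≡_ _≡_ B
        A≢v               : ∀ a → A a ≢ v
        B≢u               : ∀ b → B b ≢ u
        A≢B               : ∀ a b → A a ≢ B b
        colours-separated : ∀ a b → col c u (A a) ≢ col c v (B b)

    star : Fin n → Fin n → (Fin p → Fin n) → (Fin r → Fin n) → Fin (2 + p + r) → Fin n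
    star u v A B zero          = u
    star u v A B (suc zero)    = v
    star u v A B (suc (suc i)) = [ A , B ]′ (splitAt p i)

    module _ (proper : Proper c) {u v A B} (S : SeparatedDoubleStar u v A B) where

      open SeparatedDoubleStar S

      private
        leaf-injective : ∀ i j → [ A , B ]′ (splitAt p i) ≡ [ A , B ]′ (splitAt p j) → i ≡ j
        leaf-injective i j same with splitAt p i in split-i | splitAt p j in split-j
        ... | inj₁ a | inj₁ a′ = trans (≡.sym (splitAt⁻¹-↑ˡ split-i))
                                       (trans (cong (_↑ˡ r) (A-injective same)) (splitAt⁻¹-↑ˡ split-j))
        ... | inj₁ a | inj₂ b  = contradiction same (A≢B a b)
        ... | inj₂ b | inj₁ a  = contradiction (≡.sym same) (A≢B a b)
        ... | inj₂ b | inj₂ b′ = trans (≡.sym (splitAt⁻¹-↑ʳ split-i))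
                                       (trans (cong (p ↑ʳ_) (B-injective same)) (splitAt⁻¹-↑ʳ split-j))

        leaf≢u : ∀ i → [ A , B ]′ (splitAt p i) ≢ u
        leaf≢u i with splitAt p i
        ... | inj₁ a = adj⇒≢ G (uA-adjacent a) ∘ ≡.sym
        ... | inj₂ b = B≢u b

        leaf≢v : ∀ i → [ A , B ]′ (splitAt p i) ≢ v
        leaf≢v i with splitAt p i
        ... | inj₁ a = A≢v a
        ... | inj₂ b = adj⇒≢ G (vB-adjacent b) ∘ ≡.sym

        u≢v : u ≢ v
        u≢v = adj⇒≢ G uv-adjacent

        star-injective : Injective _≡_ _≡_ (star u v A B)
        star-injective {zero}        {zero}        _    = refl
        star-injective {zero}        {suc zero}    same = contradiction same u≢v
        star-injective {zero}        {suc (suc j)} same = contradiction (≡.sym same) (leaf≢u j)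
        star-injective {suc zero}    {zero}        same = contradiction (≡.sym same) u≢v
        star-injective {suc zero}    {suc zero}    _    = refl
        star-injective {suc zero}    {suc (suc j)} same = contradiction (≡.sym same) (leaf≢v j)
        star-injective {suc (suc i)} {zero}        same = contradiction same (leaf≢u i)
        star-injective {suc (suc i)} {suc zero}    same = contradiction same (leaf≢v i)
        star-injective {suc (suc i)} {suc (suc j)} same = cong (λ t → suc (suc t)) (leaf-injective i j same)

        star-edges : ∀ e → Adj G (star u v A B (parent e)) (star u v A B (suc e)) ≡ true
        star-edges zero = uv-adjacent
        star-edges (suc i) with splitAt p i
        ... | inj₁ a = uA-adjacent a
        ... | inj₂ b = vB-adjacent b

        leafColour : Fin (p + r) → ℕ
        leafColour i = [ col c u ∘ A , col c v ∘ B ]′ (splitAt p i)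

        edgeColour-leaf : ∀ i → edgeColour c (star u v A B) (suc i) ≡ leafColour i
        edgeColour-leaf i with splitAt p i
        ... | inj₁ _ = refl
        ... | inj₂ _ = refl

        centre-colour-unique : ∀ i → col c u v ≢ leafColour i
        centre-colour-unique i same with splitAt p i
        ... | inj₁ a = A≢v a (≡.sym (proper-injective c proper uv-adjacent (uA-adjacent a) same))
        ... | inj₂ b = B≢u b (≡.sym (proper-injective c proper (trans (sym G v u) uv-adjacent) (vB-adjacent b)
                                          (trans (≡.sym (col-sym c u v uv-adjacent)) same)))

        leafColour-injective : ∀ i j → leafColour i ≡ leafColour j → i ≡ j
        leafColour-injective i j same = leaf-injective i j (leaves-agree same)
          where
          leaves-agree : leafColour i ≡ leafColour j → [ A , B ]′ (splitAt p i) ≡ [ A , B ]′ (splitAt p j)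
          leaves-agree same with splitAt p i | splitAt p j
          ... | inj₁ a | inj₁ a′ = proper-injective c proper (uA-adjacent a) (uA-adjacent a′) same
          ... | inj₁ a | inj₂ b  = contradiction same (colours-separated a b)
          ... | inj₂ b | inj₁ a  = contradiction (≡.sym same) (colours-separated a b)
          ... | inj₂ b | inj₂ b′ = proper-injective c proper (vB-adjacent b) (vB-adjacent b′) same

        star-edgeColour-injective : Injective _≡_ _≡_ (edgeColour c (star u v A B))
        star-edgeColour-injective {zero}  {zero}  _    = refl
        star-edgeColour-injective {zero}  {suc j} same =
          contradiction (trans same (edgeColour-leaf j)) (centre-colour-unique j)
        star-edgeColour-injective {suc i} {zero}  same =
          contradiction (trans (≡.sym same) (edgeColour-leaf i)) (centre-colour-unique i)
        star-edgeColour-injective {suc i} {suc j} same = cong suc (leafColour-injective i j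
          (trans (≡.sym (edgeColour-leaf i)) (trans same (edgeColour-leaf j))))

      separated⇒rainbowCopy : Σ (Copy G (DoubleStar p r)) λ C → RainbowSub c (proj₁ C)
      separated⇒rainbowCopy = imageCopy φ , edgeColour-injective⇒rainbow c φ star-edgeColour-injective
        where
        φ : Embedding (DoubleStar p r) G
        φ = parentEdges⇒embedding (star u v A B) star-injective star-edges

  degreeBound : ℕ
  degreeBound = (2 + p + r) + ((2 + p + r) + (p + r))

  module _ {n : ℕ} {G : Graph n} (c : EdgeColoring G) (proper : Proper c)
           (noRainbow : NoRainbow c (DoubleStar p r)) (φ : Embedding (DoubleStar p r) G) where

    private
      f : Fin (2 + p + r) → Fin n
      f = vertex φ

      room : ∀ {x} (g : Fin (2 + p + r) → ℕ) q → q ≤ p + r → degreeBound ≤ degree G x →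
             length (tabulate f) + (length (tabulate g) + q) ≤ degree G x
      room g q q≤p+r large = ≤-trans
        (≤-reflexive (cong₂ _+_ (length-tabulate f) (cong (_+ q) (length-tabulate g))))
        (≤-trans (+-monoʳ-≤ (2 + p + r) (+-monoʳ-≤ (2 + p + r) q≤p+r)) large)

    degree-centreᵤ : degree G (f zero) < degreeBound
    degree-centreᵤ with degree G (f zero) ℕ.<? degreeBound
    ... | yes small = small
    ... | no large
      with fresh-neighbours c proper (f zero) (tabulate f) (tabulate (col c (f (suc zero)) ∘ f)) p
                            (room (col c (f (suc zero)) ∘ f) p (m≤m+n p r) (≮⇒≥ large))
    ... | A , A-injective , A-adjacent , A-unseen , A-fresh =
      contradiction (separated⇒rainbowCopy c proper record
        { uv-adjacent       = adjacent φ (adjacent-parent zero)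
        ; uA-adjacent       = A-adjacent
        ; vB-adjacent       = adjacent φ ∘ adjacent-leafᵥ
        ; A-injective       = A-injective
        ; B-injective       = ↑ʳ-injective p _ _ ∘ Fin.suc-injective ∘ Fin.suc-injective ∘ injective φ
        ; A≢v               = λ a → ∉-tabulate f (A-unseen a) (suc zero)
        ; B≢u               = λ b → (λ ()) ∘ injective φ
        ; A≢B               = λ a b → ∉-tabulate f (A-unseen a) (leafᵥ b)
        ; colours-separated = λ a b → ∉-tabulate (col c (f (suc zero)) ∘ f) (A-fresh a) (leafᵥ b)
        }) noRainbow

    degree-centreᵥ : degree G (f (suc zero)) < degreeBound
    degree-centreᵥ with degree G (f (suc zero)) ℕ.<? degreeBound
    ... | yes small = small
    ... | no large
      with fresh-neighbours c proper (f (suc zero)) (tabulate f) (tabulate (col c (f zero) ∘ f)) r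
                            (room (col c (f zero) ∘ f) r (m≤n+m r p) (≮⇒≥ large))
    ... | B , B-injective , B-adjacent , B-unseen , B-fresh =
      contradiction (separated⇒rainbowCopy c proper record
        { uv-adjacent       = adjacent φ (adjacent-parent zero)
        ; uA-adjacent       = adjacent φ ∘ adjacent-leafᵤ
        ; vB-adjacent       = B-adjacent
        ; A-injective       = ↑ˡ-injective r _ _ ∘ Fin.suc-injective ∘ Fin.suc-injective ∘ injective φ
        ; B-injective       = B-injective
        ; A≢v               = λ a → (λ ()) ∘ Fin.suc-injective ∘ injective φ
        ; B≢u               = λ b → ∉-tabulate f (B-unseen b) zero
        ; A≢B               = λ a b → ∉-tabulate f (B-unseen b) (leafᵤ a) ∘ ≡.sym
        ; colours-separated = λ a b → ∉-tabulate (col c (f zero) ∘ f) (B-fresh b) (leafᵤ a) ∘ ≡.sym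
        }) noRainbow

    degree-parent< : ∀ e → degree G (f (parent e)) < degreeBound
    degree-parent< e with parent e | parent-centre e
    ... | _ | inj₁ refl = degree-centreᵤ
    ... | _ | inj₂ refl = degree-centreᵥ

  module _ {n : ℕ} {G : Graph n} (c : EdgeColoring G) (proper : Proper c)
           (noRainbow : NoRainbow c (DoubleStar p r)) where

    private
      H : Graph (2 + p + r)
      H = DoubleStar p r

      vertexOf : Copy G H → Fin (2 + p + r) → Fin n
      vertexOf C = vertex (embedding {H = H} C)

      childIndex : (C : Copy G H) (e : Fin (suc (p + r))) → vertexOf C (suc e) ∈ neighbours G (vertexOf C (parent e))
      childIndex C e = ∈-neighbours⁺ G (adjacent (embedding {H = H} C) (adjacent-parent e))

      digit : Copy G H → Fin (suc (p + r)) → Fin degreeBound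
      digit C e = Fin.inject≤ (index (childIndex C e)) (<⇒≤ (degree-parent< c proper noRainbow (embedding {H = H} C) e))

      code : Copy G H → Fin (degreeBound ^ suc (p + r) * n)
      code C = combine (encode (digit C)) (vertexOf C zero)

      child-determined : ∀ C C′ e → vertexOf C (parent e) ≡ vertexOf C′ (parent e) → digit C e ≡ digit C′ e →
                         vertexOf C (suc e) ≡ vertexOf C′ (suc e)
      child-determined C C′ e parents same = neighbour-index-injective G parents (childIndex C e) (childIndex C′ e)
        (trans (≡.sym (Fin.toℕ-inject≤ _ _)) (trans (cong toℕ same) (Fin.toℕ-inject≤ _ _)))

      vertices-determined : ∀ C C′ → vertexOf C zero ≡ vertexOf C′ zero → (∀ e → digit C e ≡ digit C′ e) →
                            ∀ i → vertexOf C i ≡ vertexOf C′ i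
      vertices-determined C C′ root digits zero    = root
      vertices-determined C C′ root digits (suc e) = child-determined C C′ e parents (digits e)
        where
        parents : vertexOf C (parent e) ≡ vertexOf C′ (parent e)
        parents with parent e | parent-centre e
        ... | _ | inj₁ refl = root
        ... | _ | inj₂ refl = child-determined C C′ zero root (digits zero)

      code-injective : ∀ C C′ → code C ≡ code C′ → SameSubgraph (proj₁ C) (proj₁ C′)
      code-injective C C′ same with combine-injective (encode (digit C)) _ (encode (digit C′)) _ same
      ... | digits , root = copy-determined {H = H} C C′
        (vertices-determined C C′ root (encode-injective (digit C) (digit C′) digits))

    distinctCopies-length≤ : ∀ L → DistinctCopies G H L → length L ≤ degreeBound ^ suc (p + r) * n
    distinctCopies-length≤ L distinct = begin
      length L                                 ≡⟨ length-map code L ⟨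
      length (map code L)                      ≤⟨ length-≤-⊆ distinct-codes (λ _ → ∈-allFin _) ⟩
      length (allFin (degreeBound ^ suc (p + r) * n)) ≡⟨ length-tabulate id ⟩
      degreeBound ^ suc (p + r) * n           ∎
      where
      open ≤-Reasoning
      distinct-codes : AllPairs _≢_ (map code L)
      distinct-codes = AllPairsₚ.map⁺ (AllPairs.map (λ {C} {C′} ¬same → ¬same ∘ code-injective C C′) distinct)

  leafLabel : Fin (2 + p + r) → ℕ
  leafLabel zero          = 0
  leafLabel (suc zero)    = 0
  leafLabel (suc (suc i)) = suc ([ toℕ , toℕ ]′ (splitAt p i))

  starColouring : EdgeColoring (DoubleStar p r)
  starColouring = record
    { col     = λ i j → leafLabel i + leafLabel j
    ; col-sym = λ i j _ → +-comm (leafLabel i) (leafLabel j)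
    }

  private
    leafLabel-parent : ∀ e → leafLabel (parent e) ≡ 0
    leafLabel-parent e with parent e | parent-centre e
    ... | _ | inj₁ refl = refl
    ... | _ | inj₂ refl = refl

    leafLabel≡0 : ∀ e → leafLabel (suc e) ≡ 0 → e ≡ zero
    leafLabel≡0 zero    _  = refl
    leafLabel≡0 (suc i) ()

    edgeLabel-injective : ∀ e e′ → parent e ≡ parent e′ → leafLabel (suc e) ≡ leafLabel (suc e′) → e ≡ e′
    edgeLabel-injective zero    zero    _       _      = refl
    edgeLabel-injective zero    (suc j) _       ()
    edgeLabel-injective (suc i) zero    _       ()
    edgeLabel-injective (suc i) (suc j) parents labels with splitAt p i in split-i | splitAt p j in split-j
    ... | inj₁ a | inj₁ a′ = cong suc (trans (≡.sym (splitAt⁻¹-↑ˡ split-i))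
        (trans (cong (_↑ˡ r) (toℕ-injective (suc-injective labels))) (splitAt⁻¹-↑ˡ split-j)))
    ... | inj₂ b | inj₂ b′ = cong suc (trans (≡.sym (splitAt⁻¹-↑ʳ split-i))
        (trans (cong (p ↑ʳ_) (toℕ-injective (suc-injective labels))) (splitAt⁻¹-↑ʳ split-j)))
    ... | inj₁ _ | inj₂ _ = contradiction parents λ ()
    ... | inj₂ _ | inj₁ _ = contradiction parents λ ()

    neighbours-labelled-apart : ∀ {a b b′} → Adj (DoubleStar p r) a b ≡ true → Adj (DoubleStar p r) a b′ ≡ true →
                                leafLabel b ≡ leafLabel b′ → b ≡ b′
    neighbours-labelled-apart {a} {b} {b′} ab ab′ labels
      with adjacent⇒parent-edge a b ab | adjacent⇒parent-edge a b′ ab′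
    ... | e , inj₁ (refl , refl) | e′ , inj₁ (a↦e′ , refl) = cong suc (edgeLabel-injective e e′ a↦e′ labels)
    ... | e , inj₁ (refl , refl) | e′ , inj₂ (a≡e′+1 , refl)
      with refl ← leafLabel≡0 e (trans labels (leafLabel-parent e′)) = contradiction a≡e′+1 λ ()
    ... | e , inj₂ (refl , refl) | e′ , inj₁ (e+1≡a , refl)
      with refl ← leafLabel≡0 e′ (trans (≡.sym labels) (leafLabel-parent e)) = contradiction e+1≡a λ ()
    ... | e , inj₂ (refl , refl) | e′ , inj₂ (e+1≡e′+1 , refl) = cong parent (Fin.suc-injective e+1≡e′+1)

  starColouring-proper : Proper starColouring
  starColouring-proper a b b′ ab ab′ b≢b′ same =
    b≢b′ (neighbours-labelled-apart {a} ab ab′ (+-cancelˡ-≡ (leafLabel a) _ _ same))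

  leafLabel-bounded : 1 ≤ p → 1 ≤ r → ∀ e → leafLabel (suc e) < p + r
  leafLabel-bounded 1≤p 1≤r zero = ≤-trans 1≤p (m≤m+n p r)
  leafLabel-bounded 1≤p 1≤r (suc i) with splitAt p i
  ... | inj₁ a = ≤-<-trans (Fin.toℕ<n a) (m<m+n p 1≤r)
  ... | inj₂ b = ≤-<-trans (Fin.toℕ<n b) (m<n+m r 1≤p)

  starColouring-bounded : 1 ≤ p → 1 ≤ r → ∀ i j → Adj (DoubleStar p r) i j ≡ true →
                          col starColouring i j < p + r
  starColouring-bounded 1≤p 1≤r i j ij with adjacent⇒parent-edge i j ij
  ... | e , inj₁ (refl , refl) rewrite leafLabel-parent e = leafLabel-bounded 1≤p 1≤r e
  ... | e , inj₂ (refl , refl) rewrite leafLabel-parent e | +-identityʳ (leafLabel (suc e)) = leafLabel-bounded 1≤p 1≤r e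

  fewColours⇒noRainbow : ∀ {n} {G : Graph n} (c : EdgeColoring G) →
                         (∀ x y → Adj G x y ≡ true → col c x y < p + r) → NoRainbow c (DoubleStar p r)
  fewColours⇒noRainbow {G = G} c bounded (C , rainbow) =
    let e , e′ , e<e′ , same = pigeonhole (n<1+n (p + r)) (λ e → Fin.fromℕ< (bounded-edge e)) in
    Fin.<⇒≢ e<e′ (edgeColour-injective
      (trans (≡.sym (Fin.toℕ-fromℕ< _)) (trans (cong toℕ same) (Fin.toℕ-fromℕ< _))))
    where
    φ : Embedding (DoubleStar p r) G
    φ = embedding C
    edgeColour-injective : Injective _≡_ _≡_ (edgeColour c (vertex φ))
    edgeColour-injective = distinctlyColoured⇒edgeColour-injective c
      (rainbow⇒edgesDistinctlyColoured {H = DoubleStar p r} c C rainbow)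
    bounded-edge : ∀ e → edgeColour c (vertex φ) e < p + r
    bounded-edge e = bounded _ _ (adjacent φ (adjacent-parent e))

proposition4p2 : (p r : ℕ) → 1 ≤ p → 1 ≤ r →
    ∃[ C ] ∃[ d ] ∃[ N ] ∀ (n : ℕ) → N ≤ n →
      ((∀ (G : Graph n) (c : EdgeColoring G) → Proper c → NoRainbow c (DoubleStar p r) →
          ∀ (L : List (Copy G (DoubleStar p r))) → DistinctCopies G (DoubleStar p r) L →
          length L ≤ C * n)
      ×
      (Σ (Graph n) λ G → Σ (EdgeColoring G) λ c → Proper c × NoRainbow c (DoubleStar p r) ×
          Σ (List (Copy G (DoubleStar p r))) λ L → DistinctCopies G (DoubleStar p r) L ×
          n ≤ d * length L))
proposition4p2 p r 1≤p 1≤r =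
  degreeBound p r ^ suc (p + r) , k + k , k , λ n k≤n →
    let colouring = liftedColouring H n (starColouring p r) in
    (λ G c proper noRainbow → distinctCopies-length≤ p r c proper noRainbow) ,
    ( disjointCopies H n
    , colouring
    , liftedColouring-proper H n (starColouring p r) (starColouring-proper p r)
    , fewColours⇒noRainbow p r colouring
        (liftedColouring-bounded H n (starColouring p r) (starColouring-bounded p r 1≤p 1≤r))
    , blockCopies H n
    , blockCopies-distinct H n
    , blockCopies-many H n k≤n )
  where
  k : ℕ
  k = 2 + p + r
  H : Graph k
  H = DoubleStar p r
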